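{- Let $m$ be a positive integer, $S_{2m}$ the symmetric group on $\{1,\dots,2m\}$, and $H$ the centralizer in $S_{2m}$ of $(1\ 2)(3\ 4)\cdots(2m-1\ 2m)$. Then each double coset in $H\backslash S_{2m}/H$ has a representative supported on the odd integers $M=\{1,3,\dots,2m-1\}$ or on the even integers $M'=\{2,4,\dots,2m\}$.
   Context: A permutation is supported on a set $A$ if it fixes every point outside $A$. -}

module Defs where

open import Data.Nat using (ℕ; zero; suc; _*_; _%_)
open import Data.Fin using (Fin; zero; suc; toℕ)
open import Data.Fin.Permutation using (Permutation′; _⟨$⟩ʳ_)
open import Relation.Binary.PropositionalEquality using (_≡_)
open import Relation.Nullary using (¬_)

-- Points 1,…,2m are represented 0-indexed as Fin (2 * m): label k ↦ k - 1.
-- pairSwap is the involution (1 2)(3 4)⋯ , i.e. 0↔1, 2↔3, … (0-indexed).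
pairSwap : ∀ {n} → Fin n → Fin n
pairSwap {suc zero} zero = zero
pairSwap {suc (suc n)} zero = suc zero
pairSwap {suc (suc n)} (suc zero) = zero
pairSwap {suc (suc n)} (suc (suc i)) = suc (suc (pairSwap i))

InH : ∀ {n} → Permutation′ n → Set
InH h = ∀ i → h ⟨$⟩ʳ (pairSwap i) ≡ pairSwap (h ⟨$⟩ʳ i)

-- M = {1,3,…,2m-1}: 0-indexed, points i with toℕ i even
InM : ∀ {n} → Fin n → Set
InM i = toℕ i % 2 ≡ 0

-- M' = {2,4,…,2m}: 0-indexed, points i with toℕ i odd
InM' : ∀ {n} → Fin n → Set
InM' i = toℕ i % 2 ≡ 1

SupportedOn : ∀ {n} → Permutation′ n → (Fin n → Set) → Set
SupportedOn τ A = ∀ i → ¬ A i → τ ⟨$⟩ʳ i ≡ i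

module Submission where

open import Defs
open import Algebra.Definitions using (Involutive)
open import Data.Bool using (Bool; true; false; not; _xor_; if_then_else_)
open import Data.Bool.Properties using (not-involutive; xor-annihilates-not; xor-comm)
open import Data.Empty using (⊥-elim)
open import Data.Fin using (Fin; zero; suc)
open import Data.Fin.Permutation
  using (Permutation′; _⟨$⟩ʳ_; _⟨$⟩ˡ_; permutation; flip; _∘ₚ_; inverseˡ; inverseʳ)
open import Data.Fin.Properties using (suc-injective)
open import Data.Nat using (ℕ; zero; suc; _*_; _%_; _≤_)
open import Data.Nat.DivMod using (m*n%n≡0)
open import Data.Nat.Properties using (*-comm)
open import Data.Product using (Σ; _×_; _,_)
open import Data.Sum using (_⊎_; inj₁)
open import Relation.Binary.PropositionalEquality
  using (_≡_; _≢_; refl; sym; trans; cong; cong₂; module ≡-Reasoning)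

-- Write s = (1 2)(3 4)⋯(2m-1 2m). Both s and σ⁻¹ s σ are fixed-point-free
-- involutions, so the graph formed by their two perfect matchings is a union of
-- even cycles and has a 2-colouring t flipped by both. The element of H moving
-- each point x to the point of {x, s x} of parity t x, used on both sides of σ,
-- turns σ into a parity-preserving π. The element of H acting as π⁻¹ on M' and
-- as s π⁻¹ s on M then multiplies π to a permutation fixing M' pointwise.

private variable n : ℕ

FixedPointFree : (Fin n → Fin n) → Set
FixedPointFree f = ∀ x → f x ≢ x

Flips : (Fin n → Fin n) → (Fin n → Bool) → Set
Flips f t = ∀ x → t (f x) ≡ not (t x)

flips-partner : ∀ {f : Fin n → Fin n} {t} → Involutive _≡_ f →
  ∀ {x y} → f x ≡ y → t (f x) ≡ not (t x) → t (f y) ≡ not (t y)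
flips-partner {f = f} {t} f-involutive {x} {y} fx≡y flipsAtx = begin
  t (f y)             ≡⟨ cong (λ z → t (f z)) (sym fx≡y) ⟩
  t (f (f x))         ≡⟨ cong t (f-involutive x) ⟩
  t x                 ≡⟨ sym (not-involutive (t x)) ⟩
  not (not (t x))     ≡⟨ cong not (sym flipsAtx) ⟩
  not (t (f x))       ≡⟨ cong (λ z → not (t z)) fx≡y ⟩
  not (t y)           ∎
  where open ≡-Reasoning

pairSwap-involutive : Involutive _≡_ (pairSwap {n})
pairSwap-involutive {suc zero} zero = refl
pairSwap-involutive {suc (suc n)} zero = refl
pairSwap-involutive {suc (suc n)} (suc zero) = refl
pairSwap-involutive {suc (suc n)} (suc (suc i)) = cong (λ z → suc (suc z)) (pairSwap-involutive i)

pairSwap-fixed⇒odd : {x : Fin n} → pairSwap x ≡ x → n % 2 ≡ 1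
pairSwap-fixed⇒odd {suc zero} {zero} _ = refl
pairSwap-fixed⇒odd {suc (suc n)} {suc (suc i)} e = pairSwap-fixed⇒odd (suc-injective (suc-injective e))

pairSwap-fixedPointFree : ∀ m → FixedPointFree (pairSwap {2 * m})
pairSwap-fixedPointFree m x e
  with () ← trans (sym (trans (cong (_% 2) (*-comm 2 m)) (m*n%n≡0 m 2))) (pairSwap-fixed⇒odd e)

isOdd : Fin n → Bool
isOdd zero = false
isOdd (suc zero) = true
isOdd (suc (suc i)) = isOdd i

isOdd-pairSwap : {x : Fin n} → pairSwap x ≢ x → isOdd (pairSwap x) ≡ not (isOdd x)
isOdd-pairSwap {suc zero} {zero} ne = ⊥-elim (ne refl)
isOdd-pairSwap {suc (suc n)} {zero} ne = refl
isOdd-pairSwap {suc (suc n)} {suc zero} ne = refl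
isOdd-pairSwap {suc (suc n)} {suc (suc i)} ne = isOdd-pairSwap (λ e → ne (cong (λ z → suc (suc z)) e))

isOdd≡false⇒InM : {x : Fin n} → isOdd x ≡ false → InM x
isOdd≡false⇒InM {x = zero} _ = refl
isOdd≡false⇒InM {x = suc (suc i)} e = isOdd≡false⇒InM {x = i} e

module Contraction {n} (ψ : Fin (suc (suc n)) → Fin (suc (suc n)))
                   (ψ-involutive : Involutive _≡_ ψ) (ψ-fixedPointFree : FixedPointFree ψ) where

  ψ-symmetric : ∀ {x y} → ψ x ≡ y → ψ y ≡ x
  ψ-symmetric {x} e = trans (cong ψ (sym e)) (ψ-involutive x)

  ψ-injective : ∀ {x y} → ψ x ≡ ψ y → x ≡ y
  ψ-injective {x} {y} e = trans (sym (ψ-involutive x)) (trans (cong ψ e) (ψ-involutive y))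

  ψ₁-leavesPair : ∀ {i} → ψ zero ≡ suc (suc i) → Σ (Fin n) λ b → ψ (suc zero) ≡ suc (suc b)
  ψ₁-leavesPair e₀ with ψ (suc zero) in e₁
  ... | zero with () ← trans (sym (ψ-symmetric e₁)) e₀
  ... | suc zero = ⊥-elim (ψ-fixedPointFree (suc zero) e₁)
  ... | suc (suc b) = b , refl

  ψ₀-leavesPair : ∀ {i} → ψ (suc zero) ≡ suc (suc i) → Σ (Fin n) λ a → ψ zero ≡ suc (suc a)
  ψ₀-leavesPair e₁ with ψ zero in e₀
  ... | zero = ⊥-elim (ψ-fixedPointFree zero e₀)
  ... | suc zero with () ← trans (sym (ψ-symmetric e₀)) e₁
  ... | suc (suc a) = a , refl

  -- The contraction follows ψ from i + 2; when that lands in the pair {0, 1} it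
  -- crosses the pair and follows ψ again, which leaves the pair (the default i
  -- of leavePair is never used).
  leavePair : Fin n → Fin (suc (suc n)) → Fin n
  leavePair _ (suc (suc j)) = j
  leavePair i _ = i

  step : Fin n → Fin (suc (suc n)) → Fin n
  step i zero = leavePair i (ψ (suc zero))
  step i (suc zero) = leavePair i (ψ zero)
  step i (suc (suc j)) = j

  contract : Fin n → Fin n
  contract i = step i (ψ (suc (suc i)))

  contract-direct : ∀ {i j} → ψ (suc (suc i)) ≡ suc (suc j) → contract i ≡ j
  contract-direct {i} e = cong (step i) e

  contract-via₀ : ∀ {i b} → ψ zero ≡ suc (suc i) → ψ (suc zero) ≡ suc (suc b) → contract i ≡ b
  contract-via₀ {i} e₀ e₁ = trans (cong (step i) (ψ-symmetric e₀)) (cong (leavePair i) e₁)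

  contract-via₁ : ∀ {i a} → ψ (suc zero) ≡ suc (suc i) → ψ zero ≡ suc (suc a) → contract i ≡ a
  contract-via₁ {i} e₁ e₀ = trans (cong (step i) (ψ-symmetric e₁)) (cong (leavePair i) e₀)

  data Route (i : Fin n) : Set where
    direct : ∀ {j} → ψ (suc (suc i)) ≡ suc (suc j) → Route i
    via₀ : ψ zero ≡ suc (suc i) → Route i
    via₁ : ψ (suc zero) ≡ suc (suc i) → Route i

  route : ∀ i → Route i
  route i with ψ (suc (suc i)) in e
  ... | zero = via₀ (ψ-symmetric e)
  ... | suc zero = via₁ (ψ-symmetric e)
  ... | suc (suc j) = direct e

  contract-involutive : Involutive _≡_ contract
  contract-involutive i with route i
  ... | direct e = trans (cong contract (contract-direct e)) (contract-direct (ψ-symmetric e))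
  ... | via₀ e₀ = let b , e₁ = ψ₁-leavesPair e₀ in
    trans (cong contract (contract-via₀ e₀ e₁)) (contract-via₁ e₁ e₀)
  ... | via₁ e₁ = let a , e₀ = ψ₀-leavesPair e₁ in
    trans (cong contract (contract-via₁ e₁ e₀)) (contract-via₀ e₀ e₁)

  contract-fixedPointFree : FixedPointFree contract
  contract-fixedPointFree i fixed with route i
  ... | direct e with refl ← trans (sym (contract-direct e)) fixed = ψ-fixedPointFree _ e
  ... | via₀ e₀ with b , e₁ ← ψ₁-leavesPair e₀
    with refl ← trans (sym (contract-via₀ e₀ e₁)) fixed
    with () ← ψ-injective (trans e₁ (sym e₀))
  ... | via₁ e₁ with a , e₀ ← ψ₀-leavesPair e₁
    with refl ← trans (sym (contract-via₁ e₁ e₀)) fixed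
    with () ← ψ-injective (trans e₀ (sym e₁))

  module Extend (t′ : Fin n → Bool) (t′-pairSwap : Flips pairSwap t′) (t′-contract : Flips contract t′)
    where

    -- the colour of 0, read off its ψ-partner; when that partner is 1 any colour works
    colour₀ : Fin (suc (suc n)) → Bool
    colour₀ (suc (suc a)) = not (t′ a)
    colour₀ _ = true

    t : Fin (suc (suc n)) → Bool
    t zero = colour₀ (ψ zero)
    t (suc zero) = not (colour₀ (ψ zero))
    t (suc (suc i)) = t′ i

    t-pairSwap : Flips pairSwap t
    t-pairSwap zero = refl
    t-pairSwap (suc zero) = sym (not-involutive _)
    t-pairSwap (suc (suc i)) = t′-pairSwap i

    t-ψ₀ : t (ψ zero) ≡ not (t zero)
    t-ψ₀ with ψ zero in e₀
    ... | zero = ⊥-elim (ψ-fixedPointFree zero e₀)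
    ... | suc zero = cong (λ y → not (colour₀ y)) e₀
    ... | suc (suc a) = sym (not-involutive (t′ a))

    t-ψ₁ : t (ψ (suc zero)) ≡ not (t (suc zero))
    t-ψ₁ with ψ (suc zero) in e₁
    ... | zero = trans (cong t (sym e₁)) (flips-partner {f = ψ} {t} ψ-involutive (ψ-symmetric e₁) t-ψ₀)
    ... | suc zero = ⊥-elim (ψ-fixedPointFree (suc zero) e₁)
    ... | suc (suc b) = let a , e₀ = ψ₀-leavesPair e₁ in begin
      t′ b                          ≡⟨ cong t′ (sym (contract-via₀ e₀ e₁)) ⟩
      t′ (contract a)               ≡⟨ t′-contract a ⟩
      not (t′ a)                    ≡⟨ cong colour₀ (sym e₀) ⟩
      colour₀ (ψ zero)              ≡⟨ sym (not-involutive _) ⟩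
      not (not (colour₀ (ψ zero)))  ∎
      where open ≡-Reasoning

    t-ψ : Flips ψ t
    t-ψ zero = t-ψ₀
    t-ψ (suc zero) = t-ψ₁
    t-ψ (suc (suc i)) with route i
    ... | direct e = trans (cong t e) (trans (cong t′ (sym (contract-direct e))) (t′-contract i))
    ... | via₀ e₀ = flips-partner {f = ψ} {t} ψ-involutive e₀ t-ψ₀
    ... | via₁ e₁ = flips-partner {f = ψ} {t} ψ-involutive e₁ t-ψ₁

pairSwap-colouring : ∀ n (ψ : Fin n → Fin n) → Involutive _≡_ ψ → FixedPointFree ψ →
  Σ (Fin n → Bool) λ t → Flips pairSwap t × Flips ψ t
pairSwap-colouring zero ψ _ _ = (λ ()) , (λ ()) , (λ ())
pairSwap-colouring (suc zero) ψ _ ψ-fixedPointFree with ψ zero in e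
... | zero = ⊥-elim (ψ-fixedPointFree zero e)
pairSwap-colouring (suc (suc n)) ψ ψ-involutive ψ-fixedPointFree =
  let t′ , t′-pairSwap , t′-contract =
        pairSwap-colouring n contract contract-involutive contract-fixedPointFree
      open Extend t′ t′-pairSwap t′-contract
  in t , t-pairSwap , t-ψ
  where open Contraction ψ ψ-involutive ψ-fixedPointFree

swapIf : Bool → Fin n → Fin n
swapIf false x = x
swapIf true x = pairSwap x

swapIf-pairSwap : ∀ b (x : Fin n) → swapIf b (pairSwap x) ≡ pairSwap (swapIf b x)
swapIf-pairSwap false x = refl
swapIf-pairSwap true x = refl

swapIf-involutive : ∀ b → Involutive _≡_ (swapIf {n} b)
swapIf-involutive false x = refl
swapIf-involutive true x = pairSwap-involutive x

flips-swapIf : {t : Fin n → Bool} → Flips pairSwap t → ∀ b x → t (swapIf b x) ≡ b xor t x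
flips-swapIf _ false x = refl
flips-swapIf t-flips true x = t-flips x

xor-cancelʳ : ∀ a b → (a xor b) xor b ≡ a
xor-cancelʳ false false = refl
xor-cancelʳ false true = refl
xor-cancelʳ true false = refl
xor-cancelʳ true true = refl

InH-∘ₚ : {g h : Permutation′ n} → InH g → InH h → InH (g ∘ₚ h)
InH-∘ₚ {g = g} {h} g∈H h∈H i = trans (cong (h ⟨$⟩ʳ_) (g∈H i)) (h∈H (g ⟨$⟩ʳ i))

PreservesParity : Permutation′ n → Set
PreservesParity π = ∀ x → isOdd (π ⟨$⟩ʳ x) ≡ isOdd x

PreservesParity-flip : (π : Permutation′ n) → PreservesParity π → PreservesParity (flip π)
PreservesParity-flip π π-preserves y = trans (sym (π-preserves (π ⟨$⟩ˡ y))) (cong isOdd (inverseʳ π))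

module Centralizer {n} (pairSwap-noFixedPoint : FixedPointFree (pairSwap {n})) where

  isOdd-flips : Flips pairSwap isOdd
  isOdd-flips x = isOdd-pairSwap (pairSwap-noFixedPoint x)

  module _ (u : Fin n → Bool) (u-flips : Flips pairSwap u) where

    align : Fin n → Fin n
    align x = swapIf (u x xor isOdd x) x

    align-pairSwap : ∀ x → align (pairSwap x) ≡ pairSwap (align x)
    align-pairSwap x = begin
      swapIf (u (pairSwap x) xor isOdd (pairSwap x)) (pairSwap x)
        ≡⟨ cong₂ (λ a b → swapIf (a xor b) (pairSwap x)) (u-flips x) (isOdd-flips x) ⟩
      swapIf (not (u x) xor not (isOdd x)) (pairSwap x)
        ≡⟨ cong (λ c → swapIf c (pairSwap x)) (xor-annihilates-not (u x) (isOdd x)) ⟩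
      swapIf (u x xor isOdd x) (pairSwap x)
        ≡⟨ swapIf-pairSwap (u x xor isOdd x) x ⟩
      pairSwap (align x) ∎
      where open ≡-Reasoning

    isOdd-align : ∀ x → isOdd (align x) ≡ u x
    isOdd-align x = trans (flips-swapIf isOdd-flips (u x xor isOdd x) x) (xor-cancelʳ (u x) (isOdd x))

    u-align : ∀ x → u (align x) ≡ isOdd x
    u-align x = begin
      u (align x)                     ≡⟨ flips-swapIf u-flips (u x xor isOdd x) x ⟩
      (u x xor isOdd x) xor u x       ≡⟨ cong (_xor u x) (xor-comm (u x) (isOdd x)) ⟩
      (isOdd x xor u x) xor u x       ≡⟨ xor-cancelʳ (isOdd x) (u x) ⟩
      isOdd x                         ∎
      where open ≡-Reasoning

    align-involutive : Involutive _≡_ align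
    align-involutive x = begin
      swapIf (u (align x) xor isOdd (align x)) (align x)
        ≡⟨ cong₂ (λ a b → swapIf (a xor b) (align x)) (u-align x) (isOdd-align x) ⟩
      swapIf (isOdd x xor u x) (align x)
        ≡⟨ cong (λ c → swapIf c (align x)) (xor-comm (isOdd x) (u x)) ⟩
      swapIf (u x xor isOdd x) (swapIf (u x xor isOdd x) x)
        ≡⟨ swapIf-involutive (u x xor isOdd x) x ⟩
      x ∎
      where open ≡-Reasoning

    alignₚ : Permutation′ n
    alignₚ = permutation align align align-involutive align-involutive

    alignₚ∈H : InH alignₚ
    alignₚ∈H = align-pairSwap

  diagonal : (Fin n → Fin n) → Fin n → Fin n
  diagonal F x = if isOdd x then F x else pairSwap (F (pairSwap x))

  diagonal-odd : ∀ F {x} → isOdd x ≡ true → diagonal F x ≡ F x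
  diagonal-odd F {x} odd = cong (λ b → if b then F x else pairSwap (F (pairSwap x))) odd

  diagonal-even : ∀ F {x} → isOdd x ≡ false → diagonal F x ≡ pairSwap (F (pairSwap x))
  diagonal-even F {x} even = cong (λ b → if b then F x else pairSwap (F (pairSwap x))) even

  diagonal-pairSwap : ∀ F x → diagonal F (pairSwap x) ≡ pairSwap (diagonal F x)
  diagonal-pairSwap F x with isOdd x in parity
  ... | true = begin
    diagonal F (pairSwap x)            ≡⟨ diagonal-even F (trans (isOdd-flips x) (cong not parity)) ⟩
    pairSwap (F (pairSwap (pairSwap x))) ≡⟨ cong (λ y → pairSwap (F y)) (pairSwap-involutive x) ⟩
    pairSwap (F x)                     ∎
    where open ≡-Reasoning
  ... | false = begin
    diagonal F (pairSwap x)            ≡⟨ diagonal-odd F (trans (isOdd-flips x) (cong not parity)) ⟩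
    F (pairSwap x)                     ≡⟨ sym (pairSwap-involutive _) ⟩
    pairSwap (pairSwap (F (pairSwap x))) ∎
    where open ≡-Reasoning

  diagonal-inverse : ∀ F G → (∀ y → F (G y) ≡ y) → (∀ y → isOdd (G y) ≡ isOdd y) →
    ∀ y → diagonal F (diagonal G y) ≡ y
  diagonal-inverse F G F∘G≡id G-preserves y with isOdd y in parity
  ... | true = begin
    diagonal F (G y) ≡⟨ diagonal-odd F (trans (G-preserves y) parity) ⟩
    F (G y)          ≡⟨ F∘G≡id y ⟩
    y                ∎
    where open ≡-Reasoning
  ... | false = begin
    diagonal F (pairSwap (G (pairSwap y)))
      ≡⟨ diagonal-even F even ⟩
    pairSwap (F (pairSwap (pairSwap (G (pairSwap y)))))
      ≡⟨ cong (λ z → pairSwap (F z)) (pairSwap-involutive _) ⟩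
    pairSwap (F (G (pairSwap y)))
      ≡⟨ cong pairSwap (F∘G≡id _) ⟩
    pairSwap (pairSwap y)
      ≡⟨ pairSwap-involutive y ⟩
    y ∎
    where
    open ≡-Reasoning
    even : isOdd (pairSwap (G (pairSwap y))) ≡ false
    even = trans (isOdd-flips _) (cong not (trans (G-preserves _) (trans (isOdd-flips y) (cong not parity))))

  diagonalₚ : (π : Permutation′ n) → PreservesParity π → Permutation′ n
  diagonalₚ π π-preserves = permutation (diagonal (π ⟨$⟩ʳ_)) (diagonal (π ⟨$⟩ˡ_))
    (diagonal-inverse (π ⟨$⟩ʳ_) (π ⟨$⟩ˡ_) (λ _ → inverseʳ π) (PreservesParity-flip π π-preserves))
    (diagonal-inverse (π ⟨$⟩ˡ_) (π ⟨$⟩ʳ_) (λ _ → inverseˡ π) π-preserves)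

  diagonalₚ∈H : (π : Permutation′ n) (π-preserves : PreservesParity π) →
    InH (diagonalₚ π π-preserves)
  diagonalₚ∈H π _ = diagonal-pairSwap (π ⟨$⟩ʳ_)

  supportedOnM : (π : Permutation′ n) (π-preserves : PreservesParity π) →
    SupportedOn (π ∘ₚ diagonalₚ (flip π) (PreservesParity-flip π π-preserves)) InM
  supportedOnM π π-preserves i i∉M with isOdd i in parity
  ... | false = ⊥-elim (i∉M (isOdd≡false⇒InM {x = i} parity))
  ... | true = trans (diagonal-odd (π ⟨$⟩ˡ_) (trans (π-preserves i) parity)) (inverseˡ π)

  conjugate : Permutation′ n → Fin n → Fin n
  conjugate σ x = σ ⟨$⟩ˡ pairSwap (σ ⟨$⟩ʳ x)

  conjugate-involutive : (σ : Permutation′ n) → Involutive _≡_ (conjugate σ)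
  conjugate-involutive σ x = begin
    σ ⟨$⟩ˡ pairSwap (σ ⟨$⟩ʳ (σ ⟨$⟩ˡ pairSwap (σ ⟨$⟩ʳ x)))
      ≡⟨ cong (λ y → σ ⟨$⟩ˡ pairSwap y) (inverseʳ σ) ⟩
    σ ⟨$⟩ˡ pairSwap (pairSwap (σ ⟨$⟩ʳ x))
      ≡⟨ cong (σ ⟨$⟩ˡ_) (pairSwap-involutive _) ⟩
    σ ⟨$⟩ˡ (σ ⟨$⟩ʳ x)
      ≡⟨ inverseˡ σ ⟩
    x ∎
    where open ≡-Reasoning

  conjugate-fixedPointFree : (σ : Permutation′ n) → FixedPointFree (conjugate σ)
  conjugate-fixedPointFree σ x fixed =
    pairSwap-noFixedPoint (σ ⟨$⟩ʳ x) (trans (sym (inverseʳ σ)) (cong (σ ⟨$⟩ʳ_) fixed))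

  parityAligning : (σ : Permutation′ n) →
    Σ (Permutation′ n) λ h₁ → Σ (Permutation′ n) λ h₂ →
      InH h₁ × InH h₂ × PreservesParity (h₂ ∘ₚ σ ∘ₚ h₁)
  parityAligning σ
    with t , t-flips , t-conjugate ←
           pairSwap-colouring n (conjugate σ) (conjugate-involutive σ) (conjugate-fixedPointFree σ)
    = alignₚ u u-flips , alignₚ t t-flips , alignₚ∈H u u-flips , alignₚ∈H t t-flips , preserves
    where
    u : Fin n → Bool
    u y = t (σ ⟨$⟩ˡ y)

    u-flips : Flips pairSwap u
    u-flips y =
      trans (cong (λ z → t (σ ⟨$⟩ˡ pairSwap z)) (sym (inverseʳ σ))) (t-conjugate (σ ⟨$⟩ˡ y))

    preserves : ∀ x → isOdd (align u u-flips (σ ⟨$⟩ʳ align t t-flips x)) ≡ isOdd x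
    preserves x = begin
      isOdd (align u u-flips (σ ⟨$⟩ʳ align t t-flips x)) ≡⟨ isOdd-align u u-flips _ ⟩
      t (σ ⟨$⟩ˡ (σ ⟨$⟩ʳ align t t-flips x))            ≡⟨ cong t (inverseˡ σ) ⟩
      t (align t t-flips x)                             ≡⟨ u-align t t-flips x ⟩
      isOdd x                                           ∎
      where open ≡-Reasoning

lemma1p3 : (m : ℕ) → 1 ≤ m → (σ : Permutation′ (2 * m)) →
    Σ (Permutation′ (2 * m)) λ h₁ → Σ (Permutation′ (2 * m)) λ h₂ →
    Σ (Permutation′ (2 * m)) λ τ →
    InH h₁ × InH h₂ ×
    (∀ i → τ ⟨$⟩ʳ i ≡ h₁ ⟨$⟩ʳ (σ ⟨$⟩ʳ (h₂ ⟨$⟩ʳ i))) ×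
    (SupportedOn τ InM ⊎ SupportedOn τ InM')
lemma1p3 m _ σ
  with h₁ , h₂ , h₁∈H , h₂∈H , π-preserves ←
         Centralizer.parityAligning (pairSwap-fixedPointFree m) σ
  = h₁ ∘ₚ d , h₂ , π ∘ₚ d
  , InH-∘ₚ {g = h₁} {d} h₁∈H (diagonalₚ∈H (flip π) π⁻¹-preserves) , h₂∈H
  , (λ _ → refl) , inj₁ (supportedOnM π π-preserves)
  where
  open Centralizer (pairSwap-fixedPointFree m)
  π : Permutation′ (2 * m)
  π = h₂ ∘ₚ σ ∘ₚ h₁
  π⁻¹-preserves : PreservesParity (flip π)
  π⁻¹-preserves = PreservesParity-flip π π-preserves
  d : Permutation′ (2 * m)
  d = diagonalₚ (flip π) π⁻¹-preserves
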